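{- For positive integers $n,m$, let $P_n$ be the path on $n$ vertices and $K_m$ the complete graph on $m$ vertices. Then \[ \gamma_{1/2}(P_n \square K_m) = \left\lceil \frac{mn}{2(m+2)} \right\rceil. \]
   Context: For a graph $G=(V,E)$ and a vertex $v$, $N[v]$ denotes the closed neighborhood of $v$, and for $S\subseteq V$, $N[S]=\bigcup_{u\in S}N[u]$. For $p\in[0,1]$, a set $S\subseteq V$ is a $p$-dominating set if $|N[S]|/|V|\geq p$; $\gamma_p(G)$ is the minimum cardinality of a $p$-dominating set of $G$. $G\square H$ denotes the Cartesian product of graphs $G$ and $H$. -}

module Defs where

open import Data.Nat using (ℕ; zero; suc; _+_; _*_; _≤_; _/_; _∸_)
open import Data.Bool using (Bool; true; false; _∧_; _∨_; if_then_else_)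
open import Data.Fin using (Fin; toℕ; remQuot)
import Data.Fin as F
open import Data.Fin.Subset using (Subset; inside; outside; _∈_; ∣_∣)
open import Data.Vec using (tabulate; lookup)
open import Data.Product using (_×_; _,_; proj₁; proj₂; ∃)
open import Relation.Binary.PropositionalEquality using (_≡_)
open import Relation.Nullary using (¬_; does)
import Data.Empty

record Graph : Set where
  field
    order : ℕ
    adj   : Fin order → Fin order → Bool
    sym   : ∀ u v → adj u v ≡ adj v u
    irrefl : ∀ v → adj v v ≡ false
open Graph public

_==_ : ∀ {k} → Fin k → Fin k → Bool
i == j = does (i F.≟ j)

anyFin : ∀ k → (Fin k → Bool) → Bool
anyFin zero    f = false
anyFin (suc k) f = f F.zero ∨ anyFin k (λ i → f (F.suc i))

isIn : ∀ {k} → Subset k → Fin k → Bool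
isIn S v with lookup S v
... | inside  = true
... | outside = false

N[_]of_ : (G : Graph) → Subset (order G) → Subset (order G)
N[ G ]of S = tabulate λ v →
  if anyFin (order G) (λ u → isIn S u ∧ (u == v ∨ adj G u v)) then inside else outside

-- S is a p-dominating set for p = a / b (b > 0):  |N[S]| / |V| ≥ a / b,
-- written without division as  a * |V| ≤ b * |N[S]|.
IsPDominating : (G : Graph) (a b : ℕ) → Subset (order G) → Set
IsPDominating G a b S = a * order G ≤ b * ∣ N[ G ]of S ∣

GammaP≡ : (G : Graph) (a b : ℕ) → ℕ → Set
GammaP≡ G a b k =
  (∃ λ S → IsPDominating G a b S × ∣ S ∣ ≡ k)
  × (∀ S → IsPDominating G a b S → k ≤ ∣ S ∣)

pathAdj : ∀ n → Fin n → Fin n → Bool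
pathAdj n i j = does (suc (toℕ i) Data.Nat.≟ toℕ j) ∨ does (suc (toℕ j) Data.Nat.≟ toℕ i)

completeAdj : ∀ m → Fin m → Fin m → Bool
completeAdj m i j = Data.Bool.not (i == j)

-- Cartesian product adjacency on Fin (n * m) ≅ Fin n × Fin m (via remQuot):
-- (g,h) ~ (g',h') iff (g = g' and h ~ h') or (h = h' and g ~ g').
boxAdj : ∀ n m → (Fin n → Fin n → Bool) → (Fin m → Fin m → Bool)
       → Fin (n * m) → Fin (n * m) → Bool
boxAdj n m aG aH x y = boxAdj' aG aH (remQuot {n} m x) (remQuot {n} m y)
  where
  boxAdj' : (Fin n → Fin n → Bool) → (Fin m → Fin m → Bool)
          → Fin n × Fin m → Fin n × Fin m → Bool
  boxAdj' aG aH (g , h) (g' , h') = (g == g' ∧ aH h h') ∨ (h == h' ∧ aG g g')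

open import Data.Bool.Properties using (∨-comm; ∧-comm; ∧-zeroʳ)
open import Relation.Binary.PropositionalEquality using (refl; cong; cong₂; trans)
open import Relation.Nullary using (yes; no; Dec)
open import Data.Nat.Properties using (1+n≢n)

==-sym : ∀ {k} (i j : Fin k) → (i == j) ≡ (j == i)
==-sym i j with i F.≟ j | j F.≟ i
... | yes _ | yes _ = refl
... | no _  | no _  = refl
... | yes p | no q  = Data.Empty.⊥-elim (q (Relation.Binary.PropositionalEquality.sym p))
... | no p  | yes q = Data.Empty.⊥-elim (p (Relation.Binary.PropositionalEquality.sym q))

==-refl : ∀ {k} (i : Fin k) → (i == i) ≡ true
==-refl i with i F.≟ i
... | yes _ = refl
... | no p  = Data.Empty.⊥-elim (p refl)

sucNeq : ∀ k → does (suc k Data.Nat.≟ k) ≡ false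
sucNeq zero = refl
sucNeq (suc k) = sucNeq k

Path : ℕ → Graph
Path n = record
  { order = n ; adj = pathAdj n
  ; sym = λ u v → ∨-comm (does (suc (toℕ u) Data.Nat.≟ toℕ v)) (does (suc (toℕ v) Data.Nat.≟ toℕ u))
  ; irrefl = λ v → cong₂ _∨_ (sucNeq (toℕ v)) (sucNeq (toℕ v)) }

Complete : ℕ → Graph
Complete m = record
  { order = m ; adj = completeAdj m
  ; sym = λ u v → cong Data.Bool.not (==-sym u v)
  ; irrefl = λ v → cong Data.Bool.not (==-refl v) }

_□_ : Graph → Graph → Graph
G □ H = record
  { order = order G * order H
  ; adj = boxAdj (order G) (order H) (adj G) (adj H)
  ; sym = symB
  ; irrefl = irrB }
  where
  symB : ∀ x y → boxAdj (order G) (order H) (adj G) (adj H) x y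
               ≡ boxAdj (order G) (order H) (adj G) (adj H) y x
  symB x y =
    let g = proj₁ (remQuot {order G} (order H) x) ; h = proj₂ (remQuot {order G} (order H) x)
        g' = proj₁ (remQuot {order G} (order H) y) ; h' = proj₂ (remQuot {order G} (order H) y)
    in cong₂ _∨_ (cong₂ _∧_ (==-sym g g') (Graph.sym H h h'))
              (cong₂ _∧_ (==-sym h h') (Graph.sym G g g'))
  irrB : ∀ x → boxAdj (order G) (order H) (adj G) (adj H) x x ≡ false
  irrB x rewrite irrefl H (proj₂ (remQuot {order G} (order H) x))
               | irrefl G (proj₁ (remQuot {order G} (order H) x)) =
    let g = proj₁ (remQuot {order G} (order H) x) ; h = proj₂ (remQuot {order G} (order H) x)
    in cong₂ _∨_ (∧-zeroʳ (g == g)) (∧-zeroʳ (h == h))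

infixl 5 _□_

ceilDiv : ℕ → (b : ℕ) → .{{_ : Data.Nat.NonZero b}} → ℕ
ceilDiv a b = (a + (b ∸ 1)) / b

-- A closed neighbourhood in P_n □ K_m is a whole K_m-fibre plus at most two path neighbours,
-- so it has at most m + 2 vertices; hence a (1/2)-dominating set S satisfies
-- nm ≤ 2|N[S]| ≤ 2|S|(m + 2), i.e. |S| ≥ ⌈mn / 2(m + 2)⌉ = γ.  Conversely γ vertices suffice.
-- If 2γ ≥ n, put one vertex in every other column: each covers its whole column.  Otherwise put
-- the t-th vertex in column 2t + 1, alternating between two rows: it covers its column and one
-- vertex in each neighbouring column, and these are all distinct, m + 2 per vertex.  For m = 1
-- there is only one row, and vertices three columns apart cover three vertices each.
-- Finally, a (1/2)-dominating set of size at most γ ≤ nm can be padded to size exactly γ.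

module Submission where

open import Defs hiding (sym)
open import Data.Nat using (ℕ; zero; suc; pred; _%_; _+_; _*_; _≤_; _<_; z≤n; s≤s; s≤s⁻¹; _≤?_)
open import Data.Nat.Properties
open import Data.Nat.DivMod using (m≡m%n+[m/n]*n; m%n<n; m/n*n≤m; m<n*o⇒m/o<n)
open import Data.Nat.Tactic.RingSolver using (solve-∀)
open import Data.Bool using (Bool; true; false; _∧_; _∨_; if_then_else_)
open import Data.Bool.Properties using (∨-zeroʳ; ∧-zeroʳ; ∧-identityʳ)
open import Data.Fin as F using (Fin; toℕ; fromℕ<; combine; remQuot; _↑ˡ_; _↑ʳ_)
import Data.Fin.Properties as FP
open import Data.Fin.Subset using (Subset; inside; outside; ∣_∣; _∈_; _⊆_; ⊤)
open import Data.Fin.Subset.Properties using (s⊆s; ⊆⊤; ∣⊤∣≡n)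
open import Data.Vec using ([]; _∷_; tabulate; lookup)
open import Data.Vec.Properties using (lookup⇒[]=; []=⇒lookup)
open import Data.Product using (_×_; _,_; proj₁; proj₂; ∃)
open import Data.Sum using (_⊎_; inj₁; inj₂)
open import Data.Empty using (⊥-elim)
open import Function using (_∘′_)
open import Relation.Nullary using (Dec; yes; no; does)
open import Relation.Nullary.Decidable using (dec-true)
open import Relation.Binary.PropositionalEquality

𝟙 : Bool → ℕ
𝟙 true  = 1
𝟙 false = 0

sumFin : ∀ k → (Fin k → ℕ) → ℕ
sumFin zero    f = 0
sumFin (suc k) f = f F.zero + sumFin k (λ i → f (F.suc i))

count : ∀ k → (Fin k → Bool) → ℕ
count k p = sumFin k (λ i → 𝟙 (p i))

sumFin-mono : ∀ k {f g : Fin k → ℕ} → (∀ i → f i ≤ g i) → sumFin k f ≤ sumFin k g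
sumFin-mono zero    f≤g = z≤n
sumFin-mono (suc k) f≤g = +-mono-≤ (f≤g F.zero) (sumFin-mono k (λ i → f≤g (F.suc i)))

sumFin-cong : ∀ k {f g : Fin k → ℕ} → (∀ i → f i ≡ g i) → sumFin k f ≡ sumFin k g
sumFin-cong zero    f≡g = refl
sumFin-cong (suc k) f≡g = cong₂ _+_ (f≡g F.zero) (sumFin-cong k (λ i → f≡g (F.suc i)))

sumFin-distrib-+ : ∀ k (f g : Fin k → ℕ) → sumFin k (λ i → f i + g i) ≡ sumFin k f + sumFin k g
sumFin-distrib-+ zero    f g = refl
sumFin-distrib-+ (suc k) f g
  rewrite sumFin-distrib-+ k (λ i → f (F.suc i)) (λ i → g (F.suc i)) = +-interchange-+ (f F.zero) (g F.zero) _ _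
  where
  +-interchange-+ : ∀ a b c d → a + b + (c + d) ≡ a + c + (b + d)
  +-interchange-+ = solve-∀

sumFin-++ : ∀ a b (f : Fin (a + b) → ℕ) →
  sumFin (a + b) f ≡ sumFin a (λ i → f (i ↑ˡ b)) + sumFin b (λ i → f (a ↑ʳ i))
sumFin-++ zero    b f = refl
sumFin-++ (suc a) b f rewrite sumFin-++ a b (λ i → f (F.suc i)) = sym (+-assoc (f F.zero) _ _)

sumFin-combine : ∀ n m (f : Fin (n * m) → ℕ) →
  sumFin (n * m) f ≡ sumFin n (λ i → sumFin m (λ j → f (combine i j)))
sumFin-combine zero    m f = refl
sumFin-combine (suc n) m f rewrite sumFin-++ m (n * m) f =
  cong (sumFin m (λ j → f (j ↑ˡ (n * m))) +_) (sumFin-combine n m (λ x → f (m ↑ʳ x)))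

sumFin-if≤count* : ∀ k (p : Fin k → Bool) (f : Fin k → ℕ) {B} → (∀ i → f i ≤ B) →
  sumFin k (λ i → if p i then f i else 0) ≤ count k p * B
sumFin-if≤count* zero    p f f≤B = z≤n
sumFin-if≤count* (suc k) p f f≤B with p F.zero
... | true  = +-mono-≤ (f≤B F.zero) (sumFin-if≤count* k _ _ (λ i → f≤B (F.suc i)))
... | false = sumFin-if≤count* k _ _ (λ i → f≤B (F.suc i))

𝟙≤1 : ∀ b → 𝟙 b ≤ 1
𝟙≤1 true  = ≤-refl
𝟙≤1 false = z≤n

𝟙-mono : ∀ {a b} → (a ≡ true → b ≡ true) → 𝟙 a ≤ 𝟙 b
𝟙-mono {true}  a⇒b rewrite a⇒b refl = ≤-refl
𝟙-mono {false} a⇒b = z≤n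

𝟙-∨ : ∀ a b → 𝟙 (a ∨ b) ≤ 𝟙 a + 𝟙 b
𝟙-∨ true  b = s≤s z≤n
𝟙-∨ false b = ≤-refl

count≤ : ∀ k p → count k p ≤ k
count≤ zero    p = z≤n
count≤ (suc k) p = +-mono-≤ (𝟙≤1 (p F.zero)) (count≤ k _)

count-mono : ∀ k {p q : Fin k → Bool} → (∀ i → p i ≡ true → q i ≡ true) → count k p ≤ count k q
count-mono k p⇒q = sumFin-mono k (λ i → 𝟙-mono (p⇒q i))

count-∨ : ∀ k (p q : Fin k → Bool) → count k (λ i → p i ∨ q i) ≤ count k p + count k q
count-∨ k p q = ≤-trans (sumFin-mono k (λ i → 𝟙-∨ (p i) (q i))) (≤-reflexive (sumFin-distrib-+ k _ _))

count-none : ∀ k (p : Fin k → Bool) → (∀ i → p i ≡ false) → count k p ≡ 0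
count-none zero    p none = refl
count-none (suc k) p none rewrite none F.zero = count-none k _ (λ i → none (F.suc i))

count-all : ∀ k (p : Fin k → Bool) → (∀ i → p i ≡ true) → count k p ≡ k
count-all zero    p all = refl
count-all (suc k) p all rewrite all F.zero = cong suc (count-all k _ (λ i → all (F.suc i)))

count-unique : ∀ k (p : Fin k → Bool) → (∀ i j → p i ≡ true → p j ≡ true → i ≡ j) → count k p ≤ 1
count-unique zero    p uniq = z≤n
count-unique (suc k) p uniq with p F.zero in p0
... | true  = ≤-reflexive (cong suc (count-none k _ rest-false))
  where
  rest-false : ∀ i → p (F.suc i) ≡ false
  rest-false i with p (F.suc i) in pi
  ... | false = refl
  ... | true with () ← uniq F.zero (F.suc i) p0 pi
... | false = count-unique k _ (λ i j pi pj → FP.suc-injective (uniq (F.suc i) (F.suc j) pi pj))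

count-≥1 : ∀ k (p : Fin k → Bool) i → p i ≡ true → 1 ≤ count k p
count-≥1 (suc k) p F.zero    pi rewrite pi = s≤s z≤n
count-≥1 (suc k) p (F.suc i) pi = ≤-trans (count-≥1 k _ i pi) (m≤n+m _ (𝟙 (p F.zero)))

count-≥2 : ∀ k (p : Fin k → Bool) i j → p i ≡ true → p j ≡ true → i ≢ j → 2 ≤ count k p
count-≥2 (suc k) p F.zero    F.zero    pi pj i≢j = ⊥-elim (i≢j refl)
count-≥2 (suc k) p F.zero    (F.suc j) pi pj i≢j rewrite pi = s≤s (count-≥1 k _ j pj)
count-≥2 (suc k) p (F.suc i) F.zero    pi pj i≢j rewrite pj = s≤s (count-≥1 k _ i pi)
count-≥2 (suc k) p (F.suc i) (F.suc j) pi pj i≢j =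
  ≤-trans (count-≥2 k _ i j pi pj (i≢j ∘′ cong F.suc)) (m≤n+m _ (𝟙 (p F.zero)))

does⇒ : ∀ {a} {A : Set a} (a? : Dec A) → does a? ≡ true → A
does⇒ (yes a) _ = a

==⇒≡ : ∀ {k} (i j : Fin k) → (i == j) ≡ true → i ≡ j
==⇒≡ i j = does⇒ (i F.≟ j)

≡⇒== : ∀ {k} {i j : Fin k} → i ≡ j → (i == j) ≡ true
≡⇒== {i = i} {j} = dec-true (i F.≟ j)

count-==∧ : ∀ m (b : Fin m) x → count m (λ j → (b == j) ∧ x) ≤ 𝟙 x
count-==∧ m b true  = count-unique m (λ j → (b == j) ∧ true) same
  where
  same : ∀ i j → ((b == i) ∧ true) ≡ true → ((b == j) ∧ true) ≡ true → i ≡ j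
  same i j b≡i b≡j = trans (sym (==⇒≡ b i (trans (sym (∧-identityʳ _)) b≡i))) (==⇒≡ b j (trans (sym (∧-identityʳ _)) b≡j))
count-==∧ m b false = ≤-reflexive (count-none m _ (λ j → ∧-zeroʳ (b == j)))

anyFin-intro : ∀ k (p : Fin k → Bool) i → p i ≡ true → anyFin k p ≡ true
anyFin-intro (suc k) p F.zero    pi rewrite pi = refl
anyFin-intro (suc k) p (F.suc i) pi rewrite anyFin-intro k (λ j → p (F.suc j)) i pi = ∨-zeroʳ (p F.zero)

anyFin-elim : ∀ k (p : Fin k → Bool) → anyFin k p ≡ true → ∃ λ i → p i ≡ true
anyFin-elim (suc k) p any with p F.zero in p0
... | true  = F.zero , p0
... | false with anyFin-elim k (λ j → p (F.suc j)) any
...   | i , pi = F.suc i , pi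

subsetOf : ∀ {k} → (Fin k → Bool) → Subset k
subsetOf p = tabulate (λ i → if p i then inside else outside)

isIn-subsetOf : ∀ k (p : Fin k → Bool) i → isIn (subsetOf p) i ≡ p i
isIn-subsetOf (suc k) p F.zero with p F.zero
... | true  = refl
... | false = refl
isIn-subsetOf (suc k) p (F.suc i) = isIn-subsetOf k (λ j → p (F.suc j)) i

∣subsetOf∣≡count : ∀ k (p : Fin k → Bool) → ∣ subsetOf p ∣ ≡ count k p
∣subsetOf∣≡count zero    p = refl
∣subsetOf∣≡count (suc k) p with p F.zero
... | true  = cong suc (∣subsetOf∣≡count k (λ i → p (F.suc i)))
... | false = ∣subsetOf∣≡count k (λ i → p (F.suc i))

∣S∣≡count-isIn : ∀ k (S : Subset k) → ∣ S ∣ ≡ count k (isIn S)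
∣S∣≡count-isIn zero    []            = refl
∣S∣≡count-isIn (suc k) (inside  ∷ S) = cong suc (∣S∣≡count-isIn k S)
∣S∣≡count-isIn (suc k) (outside ∷ S) = ∣S∣≡count-isIn k S

isIn⇒∈ : ∀ {k} {S : Subset k} {i} → isIn S i ≡ true → i ∈ S
isIn⇒∈ {S = S} {i} i∈S with lookup S i in Si
... | inside = lookup⇒[]= i S Si

∈⇒isIn : ∀ {k} {S : Subset k} {i} → i ∈ S → isIn S i ≡ true
∈⇒isIn {S = S} {i} i∈S rewrite []=⇒lookup i∈S = refl

count-anyFin≤ : ∀ K N (s : Fin K → Bool) (R : Fin K → Fin N → Bool) →
  count N (λ v → anyFin K (λ u → s u ∧ R u v)) ≤ sumFin K (λ u → if s u then count N (R u) else 0)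
count-anyFin≤ zero    N s R = ≤-reflexive (count-none N _ (λ _ → refl))
count-anyFin≤ (suc K) N s R =
  ≤-trans (count-∨ N (λ v → s F.zero ∧ R F.zero v) _)
          (+-mono-≤ head (count-anyFin≤ K N (λ u → s (F.suc u)) (λ u → R (F.suc u))))
  where
  head : count N (λ v → s F.zero ∧ R F.zero v) ≤ (if s F.zero then count N (R F.zero) else 0)
  head with s F.zero
  ... | true  = ≤-refl
  ... | false = ≤-reflexive (count-none N _ (λ _ → refl))

closedAdj : (G : Graph) → Fin (order G) → Fin (order G) → Bool
closedAdj G u v = (u == v) ∨ adj G u v

∈N[S] : ∀ G {S : Subset (order G)} {u v} → isIn S u ≡ true → closedAdj G u v ≡ true →
  isIn (N[ G ]of S) v ≡ true
∈N[S] G {S} {u} {v} u∈S uv =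
  trans (isIn-subsetOf (order G) _ v)
        (anyFin-intro (order G) (λ w → isIn S w ∧ closedAdj G w v) u (cong₂ _∧_ u∈S uv))

∣N[S]∣≤∣S∣*Δ : ∀ G (S : Subset (order G)) {Δ} → (∀ u → count (order G) (closedAdj G u) ≤ Δ) →
  ∣ N[ G ]of S ∣ ≤ ∣ S ∣ * Δ
∣N[S]∣≤∣S∣*Δ G S {Δ} N[u]≤Δ = begin
  ∣ N[ G ]of S ∣                                                    ≡⟨ ∣subsetOf∣≡count (order G) _ ⟩
  count (order G) (λ v → anyFin (order G) (λ u → isIn S u ∧ closedAdj G u v))
    ≤⟨ count-anyFin≤ (order G) (order G) (isIn S) (closedAdj G) ⟩
  sumFin (order G) (λ u → if isIn S u then count (order G) (closedAdj G u) else 0)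
    ≤⟨ sumFin-if≤count* (order G) (isIn S) _ N[u]≤Δ ⟩
  count (order G) (isIn S) * Δ                                      ≡⟨ cong (_* Δ) (∣S∣≡count-isIn (order G) S) ⟨
  ∣ S ∣ * Δ                                                         ∎
  where open ≤-Reasoning

N[S]-mono : ∀ G {S S′ : Subset (order G)} → S ⊆ S′ → ∣ N[ G ]of S ∣ ≤ ∣ N[ G ]of S′ ∣
N[S]-mono G {S} {S′} S⊆S′ = begin
  ∣ N[ G ]of S ∣                     ≡⟨ ∣S∣≡count-isIn (order G) (N[ G ]of S) ⟩
  count (order G) (isIn (N[ G ]of S))  ≤⟨ count-mono (order G) grow ⟩
  count (order G) (isIn (N[ G ]of S′)) ≡⟨ ∣S∣≡count-isIn (order G) (N[ G ]of S′) ⟨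
  ∣ N[ G ]of S′ ∣                    ∎
  where
  open ≤-Reasoning
  grow : ∀ v → isIn (N[ G ]of S) v ≡ true → isIn (N[ G ]of S′) v ≡ true
  grow v v∈N[S] with anyFin-elim (order G) _ (trans (sym (isIn-subsetOf (order G) _ v)) v∈N[S])
  ... | u , uS∧uv with isIn S u in u∈S
  ...   | true = ∈N[S] G {S′} (∈⇒isIn (S⊆S′ (isIn⇒∈ u∈S))) uS∧uv

superset-of-size : ∀ N (S : Subset N) k → ∣ S ∣ ≤ k → k ≤ N → ∃ λ S′ → S ⊆ S′ × ∣ S′ ∣ ≡ k
superset-of-size zero    []            zero    _       _       = [] , (λ ()) , refl
superset-of-size (suc N) (inside ∷ S)  (suc k) (s≤s s≤k) (s≤s k≤N) with superset-of-size N S k s≤k k≤N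
... | S′ , S⊆S′ , ∣S′∣≡k = inside ∷ S′ , s⊆s S⊆S′ , cong suc ∣S′∣≡k
superset-of-size (suc N) (outside ∷ S) k s≤k k≤1+N with k ≤? N
... | yes k≤N with superset-of-size N S k s≤k k≤N
...   | S′ , S⊆S′ , ∣S′∣≡k = outside ∷ S′ , s⊆s S⊆S′ , ∣S′∣≡k
superset-of-size (suc N) (outside ∷ S) k s≤k k≤1+N | no k≰N =
  ⊤ , ⊆⊤ , trans (∣⊤∣≡n (suc N)) (≤-antisym (≰⇒> k≰N) k≤1+N)

GammaP≡-intro : ∀ G a b k → (∃ λ S → IsPDominating G a b S × ∣ S ∣ ≤ k) → k ≤ order G →
  (∀ S → IsPDominating G a b S → k ≤ ∣ S ∣) → GammaP≡ G a b k
GammaP≡-intro G a b k (S , dom , ∣S∣≤k) k≤order minimal with superset-of-size (order G) S k ∣S∣≤k k≤order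
... | S′ , S⊆S′ , ∣S′∣≡k = (S′ , ≤-trans dom (*-monoʳ-≤ b (N[S]-mono G S⊆S′)) , ∣S′∣≡k) , minimal

sumBelow : ℕ → (ℕ → ℕ) → ℕ
sumBelow zero    f = 0
sumBelow (suc A) f = f 0 + sumBelow A (λ c → f (suc c))

sumBelow-cong : ∀ A {f g : ℕ → ℕ} → (∀ c → f c ≡ g c) → sumBelow A f ≡ sumBelow A g
sumBelow-cong zero    f≡g = refl
sumBelow-cong (suc A) f≡g = cong₂ _+_ (f≡g 0) (sumBelow-cong A (λ c → f≡g (suc c)))

sumBelow-+ : ∀ A B f → sumBelow (A + B) f ≡ sumBelow A f + sumBelow B (λ c → f (A + c))
sumBelow-+ zero    B f = refl
sumBelow-+ (suc A) B f rewrite sumBelow-+ A B (λ c → f (suc c)) = sym (+-assoc (f 0) _ _)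

sumBelow-blocks : ∀ s k f {B} → (∀ t → t < k → B ≤ sumBelow s (λ i → f (t * s + i))) →
  k * B ≤ sumBelow (k * s) f
sumBelow-blocks s zero    f blocks = z≤n
sumBelow-blocks s (suc k) f {B} blocks rewrite sumBelow-+ s (k * s) f =
  +-mono-≤ (blocks 0 (s≤s z≤n)) (sumBelow-blocks s k (λ c → f (s + c)) later)
  where
  later : ∀ t → t < k → B ≤ sumBelow s (λ i → f (s + (t * s + i)))
  later t t<k = subst (B ≤_) (sumBelow-cong s (λ i → cong f (+-assoc s (t * s) i))) (blocks (suc t) (s≤s t<k))

extendFin : ∀ n → (Fin n → ℕ) → ℕ → ℕ
extendFin zero    f c       = 0
extendFin (suc n) f zero    = f F.zero
extendFin (suc n) f (suc c) = extendFin n (λ i → f (F.suc i)) c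

extendFin-fromℕ< : ∀ n f c (c<n : c < n) → extendFin n f c ≡ f (fromℕ< c<n)
extendFin-fromℕ< (suc n) f zero    c<n       = refl
extendFin-fromℕ< (suc n) f (suc c) (s≤s c<n) = extendFin-fromℕ< n (λ i → f (F.suc i)) c c<n

sumBelow-extendFin≤ : ∀ A n f → sumBelow A (extendFin n f) ≤ sumFin n f
sumBelow-extendFin≤ zero    n       f = z≤n
sumBelow-extendFin≤ (suc A) zero    f = ≤-reflexive (sumBelow-zero A)
  where
  sumBelow-zero : ∀ A → sumBelow A (extendFin zero f) ≡ 0
  sumBelow-zero zero    = refl
  sumBelow-zero (suc A) = sumBelow-zero A
sumBelow-extendFin≤ (suc A) (suc n) f = +-monoʳ-≤ (f F.zero) (sumBelow-extendFin≤ A n (λ i → f (F.suc i)))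

Adjacent : ℕ → ℕ → Set
Adjacent x y = suc x ≡ y ⊎ suc y ≡ x

pathAdj-intro : ∀ n (a i : Fin n) → Adjacent (toℕ a) (toℕ i) → pathAdj n a i ≡ true
pathAdj-intro n a i (inj₁ a+1≡i) = cong (_∨ does (suc (toℕ i) ≟ toℕ a)) (dec-true (suc (toℕ a) ≟ toℕ i) a+1≡i)
pathAdj-intro n a i (inj₂ i+1≡a) =
  trans (cong (does (suc (toℕ a) ≟ toℕ i) ∨_) (dec-true (suc (toℕ i) ≟ toℕ a) i+1≡a)) (∨-zeroʳ _)

path-degree≤2 : ∀ n (a : Fin n) → count n (pathAdj n a) ≤ 2
path-degree≤2 n a = ≤-trans (count-∨ n _ _) (+-mono-≤ (count-unique n _ right) (count-unique n _ left))
  where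
  right : ∀ i j → does (suc (toℕ a) ≟ toℕ i) ≡ true → does (suc (toℕ a) ≟ toℕ j) ≡ true → i ≡ j
  right i j a+1≡i a+1≡j = FP.toℕ-injective (trans (sym (does⇒ (suc (toℕ a) ≟ toℕ i) a+1≡i))
                                                   (does⇒ (suc (toℕ a) ≟ toℕ j) a+1≡j))
  left : ∀ i j → does (suc (toℕ i) ≟ toℕ a) ≡ true → does (suc (toℕ j) ≟ toℕ a) ≡ true → i ≡ j
  left i j i+1≡a j+1≡a = FP.toℕ-injective (suc-injective (trans (does⇒ (suc (toℕ i) ≟ toℕ a) i+1≡a)
                                                               (sym (does⇒ (suc (toℕ j) ≟ toℕ a) j+1≡a))))

alternate : ℕ → ℕ
alternate zero          = 0
alternate (suc zero)    = 1
alternate (suc (suc t)) = alternate t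

alternate<2 : ∀ t → alternate t < 2
alternate<2 zero          = s≤s z≤n
alternate<2 (suc zero)    = s≤s (s≤s z≤n)
alternate<2 (suc (suc t)) = alternate<2 t

alternate-suc≢ : ∀ t → alternate t ≢ alternate (suc t)
alternate-suc≢ zero          ()
alternate-suc≢ (suc zero)    ()
alternate-suc≢ (suc (suc t)) = alternate-suc≢ t

*-double : ∀ a b → a * (2 * b) ≡ 2 * (a * b)
*-double = solve-∀

module PathBoxComplete (n m : ℕ) where

  G : Graph
  G = Path n □ Complete m

  adj-combine : ∀ a b i j →
    adj G (combine a b) (combine i j) ≡ ((a == i) ∧ completeAdj m b j) ∨ ((b == j) ∧ pathAdj n a i)
  adj-combine a b i j = cong₂ coordinateAdj (FP.remQuot-combine a b) (FP.remQuot-combine i j)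
    where
    coordinateAdj : Fin n × Fin m → Fin n × Fin m → Bool
    coordinateAdj (a , b) (i , j) = ((a == i) ∧ completeAdj m b j) ∨ ((b == j) ∧ pathAdj n a i)

  closedAdj-otherColumn : ∀ a b i j → (a == i) ≡ false →
    closedAdj G (combine a b) (combine i j) ≡ (b == j) ∧ pathAdj n a i
  closedAdj-otherColumn a b i j a≢i rewrite adj-combine a b i j | a≢i
    with combine a b == combine i j in same
  ... | false = refl
  ... | true with () ← trans (sym a≢i) (≡⇒== (FP.combine-injectiveˡ a b i j (==⇒≡ _ _ same)))

  column-closedAdj≤ : ∀ a b i →
    count m (λ j → closedAdj G (combine a b) (combine i j)) ≤ (if a == i then m else 0) + 𝟙 (pathAdj n a i)
  column-closedAdj≤ a b i with a == i in a≟i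
  ... | true  = ≤-trans (count≤ m _) (m≤m+n m _)
  ... | false = begin
    count m (λ j → closedAdj G (combine a b) (combine i j)) ≡⟨ sumFin-cong m (λ j → cong 𝟙 (closedAdj-otherColumn a b i j a≟i)) ⟩
    count m (λ j → (b == j) ∧ pathAdj n a i)               ≤⟨ count-==∧ m b (pathAdj n a i) ⟩
    𝟙 (pathAdj n a i)                                      ∎
    where open ≤-Reasoning

  closedNbhd-combine≤ : ∀ a b → count (n * m) (closedAdj G (combine a b)) ≤ m + 2
  closedNbhd-combine≤ a b = begin
    count (n * m) (closedAdj G (combine a b))
      ≡⟨ sumFin-combine n m _ ⟩
    sumFin n (λ i → count m (λ j → closedAdj G (combine a b) (combine i j)))
      ≤⟨ sumFin-mono n (column-closedAdj≤ a b) ⟩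
    sumFin n (λ i → (if a == i then m else 0) + 𝟙 (pathAdj n a i))
      ≡⟨ sumFin-distrib-+ n _ _ ⟩
    sumFin n (λ i → if a == i then m else 0) + count n (pathAdj n a)
      ≤⟨ +-mono-≤ (sumFin-if≤count* n (a ==_) (λ _ → m) (λ _ → ≤-refl)) (path-degree≤2 n a) ⟩
    count n (a ==_) * m + 2
      ≤⟨ +-monoˡ-≤ 2 (*-monoˡ-≤ m (count-unique n (a ==_) (λ i j a≡i a≡j → trans (sym (==⇒≡ a i a≡i)) (==⇒≡ a j a≡j)))) ⟩
    1 * m + 2
      ≡⟨ cong (_+ 2) (*-identityˡ m) ⟩
    m + 2 ∎
    where open ≤-Reasoning

  closedNbhd≤ : ∀ u → count (n * m) (closedAdj G u) ≤ m + 2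
  closedNbhd≤ u = subst (λ v → count (n * m) (closedAdj G v) ≤ m + 2) (FP.combine-remQuot {n} m u)
                        (closedNbhd-combine≤ (proj₁ (remQuot {n} m u)) (proj₂ (remQuot {n} m u)))

  closedAdj-sameColumn : ∀ a b j → closedAdj G (combine a b) (combine a j) ≡ true
  closedAdj-sameColumn a b j with b == j in b≟j
  ... | true  = cong (_∨ adj G (combine a b) (combine a j)) (≡⇒== (cong (combine a) (==⇒≡ b j b≟j)))
  ... | false rewrite adj-combine a b a j | ==-refl a | b≟j = ∨-zeroʳ _

  closedAdj-sameRow : ∀ a b i → pathAdj n a i ≡ true → closedAdj G (combine a b) (combine i b) ≡ true
  closedAdj-sameRow a b i a~i rewrite adj-combine a b i b | ==-refl b | a~i =
    trans (cong ((combine a b == combine i b) ∨_) (∨-zeroʳ ((a == i) ∧ false))) (∨-zeroʳ _)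

  module Placement (k : ℕ) (col row : ℕ → ℕ)
                   (col<n : ∀ t → t < k → col t < n) (row<m : ∀ t → t < k → row t < m) where

    column : Fin k → Fin n
    column t = fromℕ< (col<n (toℕ t) (FP.toℕ<n t))

    line : Fin k → Fin m
    line t = fromℕ< (row<m (toℕ t) (FP.toℕ<n t))

    stone : Fin k → Fin (n * m)
    stone t = combine (column t) (line t)

    stones : Subset (n * m)
    stones = subsetOf (λ v → anyFin k (λ t → v == stone t))

    ∣stones∣≤k : ∣ stones ∣ ≤ k
    ∣stones∣≤k = begin
      ∣ stones ∣                                        ≡⟨ ∣subsetOf∣≡count (n * m) _ ⟩
      count (n * m) (λ v → anyFin k (λ t → v == stone t)) ≤⟨ count-anyFin≤ k (n * m) (λ _ → true) (λ t v → v == stone t) ⟩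
      sumFin k (λ t → count (n * m) (_== stone t))       ≤⟨ sumFin-if≤count* k (λ _ → true) _ (λ t → count-unique (n * m) _ (at-most-one t)) ⟩
      count k (λ _ → true) * 1                          ≡⟨ cong (_* 1) (count-all k _ (λ _ → refl)) ⟩
      k * 1                                             ≡⟨ *-identityʳ k ⟩
      k                                                 ∎
      where
      open ≤-Reasoning
      at-most-one : ∀ t u v → (u == stone t) ≡ true → (v == stone t) ≡ true → u ≡ v
      at-most-one t u v u≡t v≡t = trans (==⇒≡ u _ u≡t) (sym (==⇒≡ v _ v≡t))

    covered : Fin n → Fin m → Bool
    covered i j = isIn (N[ G ]of stones) (combine i j)

    stone-covers : ∀ t {i j} → closedAdj G (stone t) (combine i j) ≡ true → covered i j ≡ true
    stone-covers t = ∈N[S] G {stones} (trans (isIn-subsetOf (n * m) _ (stone t)) (anyFin-intro k _ t (==-refl (stone t))))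

    -- Vanishes beyond the last column, so that sums over any range of columns bound ∣N[S]∣.
    coverage : ℕ → ℕ
    coverage = extendFin n (λ i → count m (covered i))

    sumBelow-coverage≤ : ∀ A → sumBelow A coverage ≤ ∣ N[ G ]of stones ∣
    sumBelow-coverage≤ A = begin
      sumBelow A coverage                          ≤⟨ sumBelow-extendFin≤ A n _ ⟩
      sumFin n (λ i → count m (covered i))         ≡⟨ sumFin-combine n m _ ⟨
      count (n * m) (isIn (N[ G ]of stones))       ≡⟨ ∣S∣≡count-isIn (n * m) (N[ G ]of stones) ⟨
      ∣ N[ G ]of stones ∣                          ∎
      where open ≤-Reasoning

    toℕ-column : ∀ t (t<k : t < k) → toℕ (column (fromℕ< t<k)) ≡ col t
    toℕ-column t t<k = trans (FP.toℕ-fromℕ< _) (cong col (FP.toℕ-fromℕ< t<k))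

    toℕ-line : ∀ t (t<k : t < k) → toℕ (line (fromℕ< t<k)) ≡ row t
    toℕ-line t t<k = trans (FP.toℕ-fromℕ< _) (cong row (FP.toℕ-fromℕ< t<k))

    coverage-stoneColumn : ∀ t → t < k → m ≤ coverage (col t)
    coverage-stoneColumn t t<k = ≤-reflexive (sym (begin
      coverage (col t)                                ≡⟨ extendFin-fromℕ< n _ (col t) (col<n t t<k) ⟩
      count m (covered (fromℕ< (col<n t t<k)))        ≡⟨ cong (λ i → count m (covered i)) (FP.toℕ-injective (trans (FP.toℕ-fromℕ< _) (sym (toℕ-column t t<k)))) ⟩
      count m (covered (column (fromℕ< t<k)))         ≡⟨ count-all m _ (λ j → stone-covers (fromℕ< t<k) (closedAdj-sameColumn _ _ j)) ⟩
      m                                               ∎))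
      where open ≡-Reasoning

    neighbour-covered : ∀ t (t<k : t < k) c (c<n : c < n) → Adjacent (col t) c →
      covered (fromℕ< c<n) (line (fromℕ< t<k)) ≡ true
    neighbour-covered t t<k c c<n adjacent =
      stone-covers (fromℕ< t<k) (closedAdj-sameRow _ _ _ (pathAdj-intro n _ _
        (subst₂ Adjacent (sym (toℕ-column t t<k)) (sym (FP.toℕ-fromℕ< c<n)) adjacent)))

    coverage-neighbour : ∀ t → t < k → ∀ c → c < n → Adjacent (col t) c → 1 ≤ coverage c
    coverage-neighbour t t<k c c<n adjacent = subst (1 ≤_) (sym (extendFin-fromℕ< n _ c c<n))
      (count-≥1 m _ _ (neighbour-covered t t<k c c<n adjacent))

    coverage-twoNeighbours : ∀ t₁ t₂ → t₁ < k → t₂ < k → ∀ c → c < n →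
      Adjacent (col t₁) c → Adjacent (col t₂) c → row t₁ ≢ row t₂ → 2 ≤ coverage c
    coverage-twoNeighbours t₁ t₂ t₁<k t₂<k c c<n adjacent₁ adjacent₂ rows≢ =
      subst (2 ≤_) (sym (extendFin-fromℕ< n _ c c<n))
        (count-≥2 m _ _ _ (neighbour-covered t₁ t₁<k c c<n adjacent₁) (neighbour-covered t₂ t₂<k c c<n adjacent₂)
          (λ lines≡ → rows≢ (trans (sym (toℕ-line t₁ t₁<k)) (trans (cong toℕ lines≡) (toℕ-line t₂ t₂<k)))))

  HalfDominatingWithin : ℕ → Set
  HalfDominatingWithin k = ∃ λ S → IsPDominating G 1 2 S × ∣ S ∣ ≤ k

  covering⇒halfDominating : ∀ (S : Subset (n * m)) X → X ≤ ∣ N[ G ]of S ∣ → n * m ≤ 2 * X → IsPDominating G 1 2 S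
  covering⇒halfDominating S X X≤∣N[S]∣ nm≤2X = ≤-trans (≤-reflexive (*-identityˡ _)) (≤-trans nm≤2X (*-monoʳ-≤ 2 X≤∣N[S]∣))

  halfDominating⇒ : ∀ S → IsPDominating G 1 2 S → n * m ≤ ∣ S ∣ * (2 * (m + 2))
  halfDominating⇒ S dominating = begin
    n * m                   ≡⟨ *-identityˡ _ ⟨
    1 * (n * m)             ≤⟨ dominating ⟩
    2 * ∣ N[ G ]of S ∣      ≤⟨ *-monoʳ-≤ 2 (∣N[S]∣≤∣S∣*Δ G S closedNbhd≤) ⟩
    2 * (∣ S ∣ * (m + 2))   ≡⟨ *-double ∣ S ∣ (m + 2) ⟨
    ∣ S ∣ * (2 * (m + 2))   ∎
    where open ≤-Reasoning

  everyOtherColumn : ∀ k → 0 < m → n ≤ k * 2 → k * 2 ≤ suc n → HalfDominatingWithin k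
  everyOtherColumn k 0<m n≤2k 2k≤n+1 = stones , covering⇒halfDominating stones (k * m) fullColumns nm≤2km , ∣stones∣≤k
    where
    col<n : ∀ t → t < k → t * 2 < n
    col<n t t<k = s≤s⁻¹ (≤-trans (*-monoˡ-≤ 2 t<k) 2k≤n+1)
    open Placement k (_* 2) (λ _ → 0) col<n (λ _ _ → 0<m)
    fullColumns : k * m ≤ ∣ N[ G ]of stones ∣
    fullColumns = ≤-trans (sumBelow-blocks 2 k coverage block) (sumBelow-coverage≤ (k * 2))
      where
      block : ∀ t → t < k → m ≤ sumBelow 2 (λ i → coverage (t * 2 + i))
      block t t<k = ≤-trans (subst (λ c → m ≤ coverage c) (sym (+-identityʳ (t * 2))) (coverage-stoneColumn t t<k))
                            (m≤m+n _ _)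
    nm≤2km : n * m ≤ 2 * (k * m)
    nm≤2km = ≤-trans (*-monoˡ-≤ m n≤2k) (≤-reflexive (trans (cong (_* m) (*-comm k 2)) (*-assoc 2 k m)))

  everyThirdColumn : ∀ k → 0 < m → k * 3 ≤ n → n * m ≤ k * 6 → HalfDominatingWithin k
  everyThirdColumn k 0<m 3k≤n nm≤6k = stones , dominating , ∣stones∣≤k
    where
    block-fits : ∀ t → t < k → ∀ i → i < 3 → t * 3 + i < n
    block-fits t t<k i i<3 =
      ≤-trans (+-monoʳ-< (t * 3) i<3) (≤-trans (≤-reflexive (+-comm (t * 3) 3)) (≤-trans (*-monoˡ-≤ 3 t<k) 3k≤n))
    open Placement k (λ t → t * 3 + 1) (λ _ → 0) (λ t t<k → block-fits t t<k 1 (s≤s (s≤s z≤n))) (λ _ _ → 0<m)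
    block : ∀ t → t < k → 3 ≤ sumBelow 3 (λ i → coverage (t * 3 + i))
    block t t<k = +-mono-≤ left (+-mono-≤ (≤-trans 0<m (coverage-stoneColumn t t<k)) (+-mono-≤ right z≤n))
      where
      left : 1 ≤ coverage (t * 3 + 0)
      left = coverage-neighbour t t<k _ (block-fits t t<k 0 (s≤s z≤n)) (inj₂ (sym (+-suc (t * 3) 0)))
      right : 1 ≤ coverage (t * 3 + 2)
      right = coverage-neighbour t t<k _ (block-fits t t<k 2 (s≤s (s≤s (s≤s z≤n)))) (inj₁ (sym (+-suc (t * 3) 1)))
    dominating : 1 * (n * m) ≤ 2 * ∣ N[ G ]of stones ∣
    dominating = begin
      1 * (n * m)     ≡⟨ *-identityˡ _ ⟩
      n * m           ≤⟨ nm≤6k ⟩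
      k * 6           ≡⟨ *-assoc k 2 3 ⟨
      k * 2 * 3       ≡⟨ cong (_* 3) (*-comm k 2) ⟩
      2 * k * 3       ≡⟨ *-assoc 2 k 3 ⟩
      2 * (k * 3)     ≤⟨ *-monoʳ-≤ 2 (≤-trans (sumBelow-blocks 3 k coverage block) (sumBelow-coverage≤ (k * 3))) ⟩
      2 * ∣ N[ G ]of stones ∣ ∎
      where open ≤-Reasoning

  staggeredColumns : ∀ k → 2 ≤ m → k * 2 < n → n * m ≤ 2 * (k * (m + 2)) → HalfDominatingWithin k
  staggeredColumns k 2≤m 2k<n nm≤2k[m+2] =
    stones , covering⇒halfDominating stones (k * (m + 2)) (coverage≥ k refl) nm≤2k[m+2] , ∣stones∣≤k
    where
    col<n : ∀ t → t < k → t * 2 + 1 < n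
    col<n t t<k = ≤-trans (s≤s (≤-reflexive (+-comm (t * 2) 1))) (≤-trans (*-monoˡ-≤ 2 t<k) (<⇒≤ 2k<n))
    open Placement k (λ t → t * 2 + 1) alternate col<n (λ t _ → ≤-trans (alternate<2 t) 2≤m)
    -- Columns 0 and 2k are covered once, each stone column fully, and each column between two
    -- stones twice, since consecutive stones lie in different rows.
    coverage≥ : ∀ k′ → k′ ≡ k → k′ * (m + 2) ≤ ∣ N[ G ]of stones ∣
    coverage≥ zero      _    = z≤n
    coverage≥ (suc k′) refl = begin
      suc k′ * (m + 2)
        ≡⟨ regroup k′ m ⟩
      1 + (m + (k′ * (2 + m) + (1 + 0)))
        ≤⟨ +-mono-≤ first (+-mono-≤ (coverage-stoneColumn 0 (s≤s z≤n))
             (+-mono-≤ (sumBelow-blocks 2 k′ later inner) (+-mono-≤ last z≤n))) ⟩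
      coverage 0 + (coverage 1 + (sumBelow (k′ * 2) later + sumBelow 1 (λ c → later (k′ * 2 + c))))
        ≡⟨ cong (λ x → coverage 0 + (coverage 1 + x)) (sumBelow-+ (k′ * 2) 1 later) ⟨
      sumBelow (2 + (k′ * 2 + 1)) coverage
        ≤⟨ sumBelow-coverage≤ (2 + (k′ * 2 + 1)) ⟩
      ∣ N[ G ]of stones ∣ ∎
      where
      open ≤-Reasoning
      regroup : ∀ a b → suc a * (b + 2) ≡ 1 + (b + (a * (2 + b) + (1 + 0)))
      regroup = solve-∀
      later : ℕ → ℕ
      later c = coverage (2 + c)
      first : 1 ≤ coverage 0
      first = coverage-neighbour 0 (s≤s z≤n) 0 (≤-trans (s≤s z≤n) 2k<n) (inj₂ refl)
      inner : ∀ t → t < k′ → 2 + m ≤ sumBelow 2 (λ i → later (t * 2 + i))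
      inner t t<k′ = +-mono-≤
        (coverage-twoNeighbours t (suc t) (m<n⇒m<1+n t<k′) (s≤s t<k′) _
          (<-trans (s≤s (s≤s (+-monoʳ-< (t * 2) (n<1+n 0)))) (col<n (suc t) (s≤s t<k′)))
          (inj₁ (cong suc (+-suc (t * 2) 0))) (inj₂ (cong (λ c → suc (suc c)) (sym (+-suc (t * 2) 0))))
          (alternate-suc≢ t))
        (≤-trans (coverage-stoneColumn (suc t) (s≤s t<k′)) (m≤m+n _ 0))
      last : 1 ≤ later (k′ * 2 + 0)
      last = coverage-neighbour k′ (n<1+n k′) _ (subst (_< n) (cong (λ c → suc (suc c)) (sym (+-identityʳ _))) 2k<n)
               (inj₁ (cong suc (+-suc (k′ * 2) 0)))

ceilDiv-upper : ∀ a b → ceilDiv a (suc b) * suc b ≤ a + b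
ceilDiv-upper a b = m/n*n≤m (a + b) (suc b)

ceilDiv-lower : ∀ a b → a ≤ ceilDiv a (suc b) * suc b
ceilDiv-lower a b = +-cancelʳ-≤ b a _ (begin
  a + b                       ≡⟨ m≡m%n+[m/n]*n (a + b) (suc b) ⟩
  (a + b) % suc b + q * suc b ≤⟨ +-monoˡ-≤ (q * suc b) (s≤s⁻¹ (m%n<n (a + b) (suc b))) ⟩
  b + q * suc b               ≡⟨ +-comm b _ ⟩
  q * suc b + b               ∎)
  where
  open ≤-Reasoning
  q = ceilDiv a (suc b)

ceilDiv-least : ∀ a b s → a ≤ s * suc b → ceilDiv a (suc b) ≤ s
ceilDiv-least a b s a≤sb = s≤s⁻¹ (m<n*o⇒m/o<n (begin-strict
  a + b           ≤⟨ +-monoˡ-≤ b a≤sb ⟩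
  s * suc b + b   <⟨ +-monoʳ-< (s * suc b) (n<1+n b) ⟩
  s * suc b + suc b ≡⟨ +-comm (s * suc b) _ ⟩
  suc s * suc b   ∎))
  where open ≤-Reasoning

gammaHalf : ℕ → ℕ → ℕ
gammaHalf n m = ceilDiv (suc m * suc n) (2 * (suc m + 2))

gammaHalf-lower : ∀ n m → suc m * suc n ≤ gammaHalf n m * (2 * (suc m + 2))
gammaHalf-lower n m = ceilDiv-lower (suc m * suc n) (pred (2 * (suc m + 2)))

gammaHalf-upper : ∀ n m → gammaHalf n m * (2 * (suc m + 2)) ≤ suc m * suc n + (2 * m + 5)
gammaHalf-upper n m = ≤-trans (ceilDiv-upper (suc m * suc n) (pred (2 * (suc m + 2)))) (≤-reflexive (cong (suc m * suc n +_) (cong pred (double m))))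
  where
  double : ∀ m → 2 * (suc m + 2) ≡ suc (2 * m + 5)
  double = solve-∀

gammaHalf-least : ∀ n m s → suc m * suc n ≤ s * (2 * (suc m + 2)) → gammaHalf n m ≤ s
gammaHalf-least n m s = ceilDiv-least (suc m * suc n) (pred (2 * (suc m + 2))) s

gammaHalf*2≤ : ∀ n m → gammaHalf n m * 2 ≤ suc (suc n)
gammaHalf*2≤ n m = s≤s⁻¹ (*-cancelʳ-< (suc m + 2) (γ * 2) (3 + n) (begin-strict
  γ * 2 * (suc m + 2)                              ≡⟨ *-assoc γ 2 _ ⟩
  γ * (2 * (suc m + 2))                            ≤⟨ gammaHalf-upper n m ⟩
  suc m * suc n + (2 * m + 5)                      <⟨ s≤s (m≤m+n _ (2 * n + 2)) ⟩
  suc (suc m * suc n + (2 * m + 5) + (2 * n + 2))  ≡⟨ expand m n ⟩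
  (3 + n) * (suc m + 2)                            ∎))
  where
  open ≤-Reasoning
  γ = gammaHalf n m
  expand : ∀ m n → suc (suc m * suc n + (2 * m + 5) + (2 * n + 2)) ≡ (3 + n) * (suc m + 2)
  expand = solve-∀

gammaHalf≤order : ∀ n m → gammaHalf n m ≤ suc n * suc m
gammaHalf≤order n m = ≤-trans γ≤n+1 (m≤m*n (suc n) (suc m))
  where
  γ≤n+1 : gammaHalf n m ≤ suc n
  γ≤n+1 = *-cancelʳ-≤ (gammaHalf n m) (suc n) 2 (≤-trans (gammaHalf*2≤ n m) (s≤s (s≤s (m≤m*n n 2))))

*3≤ : ∀ k x → k * 6 ≤ x + 5 → k * 2 < x → k * 3 ≤ x
*3≤ zero          x _     _     = z≤n
*3≤ (suc zero)    x _     3≤x   = 3≤x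
*3≤ (suc (suc j)) x 6k≤x+5 _ = m+n≤o⇒m≤o _ (+-cancelʳ-≤ 5 _ _ (≤-trans (≤-reflexive (split j)) 6k≤x+5))
  where
  split : ∀ j → suc (suc j) * 3 + (1 + 3 * j) + 5 ≡ suc (suc j) * 6
  split = solve-∀

upperBound : ∀ n m → PathBoxComplete.HalfDominatingWithin (suc n) (suc m) (gammaHalf n m)
upperBound n m with suc n ≤? gammaHalf n m * 2
... | yes n≤2γ = PathBoxComplete.everyOtherColumn (suc n) (suc m) (gammaHalf n m) (s≤s z≤n) n≤2γ (gammaHalf*2≤ n m)
upperBound n zero    | no n≰2γ =
  PathBoxComplete.everyThirdColumn (suc n) 1 γ (s≤s z≤n)
    (*3≤ γ (suc n) (≤-trans (gammaHalf-upper n 0) (≤-reflexive (cong (_+ 5) (*-identityˡ (suc n))))) (≰⇒> n≰2γ))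
    (≤-trans (≤-reflexive (*-comm (suc n) 1)) (gammaHalf-lower n 0))
  where γ = gammaHalf n zero
upperBound n (suc m) | no n≰2γ =
  PathBoxComplete.staggeredColumns (suc n) (2 + m) γ (s≤s (s≤s z≤n)) (≰⇒> n≰2γ)
    (≤-trans (≤-reflexive (*-comm (suc n) (2 + m)))
             (≤-trans (gammaHalf-lower n (suc m)) (≤-reflexive (*-double γ (suc (suc m) + 2)))))
  where γ = gammaHalf n (suc m)

mainTheorem3 : (n m : ℕ) →
    GammaP≡ (Path (suc n) □ Complete (suc m)) 1 2
      (ceilDiv (suc m * suc n) (2 * (suc m + 2)))
mainTheorem3 n m = GammaP≡-intro G 1 2 (gammaHalf n m) (upperBound n m) (gammaHalf≤order n m) lowerBound
  where
  open PathBoxComplete (suc n) (suc m)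
  lowerBound : ∀ S → IsPDominating G 1 2 S → gammaHalf n m ≤ ∣ S ∣
  lowerBound S dominating =
    gammaHalf-least n m ∣ S ∣ (subst (_≤ ∣ S ∣ * (2 * (suc m + 2))) (*-comm (suc n) (suc m)) (halfDominating⇒ S dominating))
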